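{- Let $G=(V,E)$ be a connected simple undirected graph whose edge set carries a fixed total order $<$, and let $F$ be a connected bipartite edge set of $G$. Then for any two distinct $e,f\in N_E(G,F)$, $$\mathcal{S}_{\mathrm{sub}}(G(F,\ge e),\,F\cup\{e\})\cap\mathcal{S}_{\mathrm{sub}}(G(F,\ge f),\,F\cup\{f\})=\emptyset.$$
   Context: For an edge set $F$ of a graph $H$, $G[F]=(V[F],F)$ where $V[F]$ is the set of endpoints of edges of $F$. A connected bipartite edge set of $H$ is a nonempty edge set $F$ such that $(V[F],F)$ is connected and bipartite (no odd cycle). $\mathcal{S}_{\mathrm{sub}}(H,F)$ is the collection of connected bipartite edge sets $F'$ of $H$ with $F\subseteq F'$. Two edges are adjacent if they share an endpoint. For an edge $e$, $N_E(G,e)$ is the set of edges of $G$ other than $e$ adjacent to $e$, and $N_E(G,F)=\big(\bigcup_{e\in F}N_E(G,e)\big)\setminus F$. For $e\in N_E(G,F)$, $G(F,\ge e)$ is the graph obtained from $G$ by deleting the edges $\{f\in N_E(G,F): f<e\}$. -}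

module Defs where

open import Data.Nat using (ℕ)
open import Data.Fin using (Fin)
open import Data.Bool using (Bool)
open import Data.Product using (Σ; ∃; _×_; _,_)
open import Data.Sum using (_⊎_)
open import Level using (0ℓ)
open import Relation.Binary.PropositionalEquality using (_≡_; _≢_)
open import Relation.Nullary using (¬_)
open import Relation.Unary using (Pred; _∈_; _∉_; _⊆_; Satisfiable; U)

-- A finite simple undirected graph with vertex set Fin n and edge set Fin m.
-- Edge e joins the (unordered) pair {src e , tgt e}.
record SimpleGraph (n m : ℕ) : Set where
  field
    src tgt    : Fin m → Fin n
    loopless   : ∀ e → src e ≢ tgt e
    noParallel : ∀ e f →
      ((src e ≡ src f × tgt e ≡ tgt f) ⊎ (src e ≡ tgt f × tgt e ≡ src f)) → e ≡ f
open SimpleGraph public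

EdgeSet : ℕ → Set₁
EdgeSet m = Pred (Fin m) 0ℓ

module _ {n m : ℕ} (G : SimpleGraph n m) where

  Incident : Fin n → Fin m → Set
  Incident v e = v ≡ src G e ⊎ v ≡ tgt G e

  Joins : Fin m → Fin n → Fin n → Set
  Joins e u w = (src G e ≡ u × tgt G e ≡ w) ⊎ (src G e ≡ w × tgt G e ≡ u)

  VertsOf : EdgeSet m → Pred (Fin n) 0ℓ
  VertsOf F v = ∃ λ e → e ∈ F × Incident v e

  data Reach (F : EdgeSet m) : Fin n → Fin n → Set where
    here : ∀ {u} → Reach F u u
    step : ∀ {u w v} e → e ∈ F → Joins e u w → Reach F w v → Reach F u v

  GraphConnected : Set
  GraphConnected = ∀ u v → Reach U u v

  ConnectedEdgeSet : EdgeSet m → Set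
  ConnectedEdgeSet F = ∀ u v → u ∈ VertsOf F → v ∈ VertsOf F → Reach F u v

  BipartiteEdgeSet : EdgeSet m → Set
  BipartiteEdgeSet F = ∃ λ (c : Fin n → Bool) → ∀ e → e ∈ F → c (src G e) ≢ c (tgt G e)

  ConnBip : EdgeSet m → Set
  ConnBip F = Satisfiable F × ConnectedEdgeSet F × BipartiteEdgeSet F

  -- F' ∈ S_sub(H, F), where H is the spanning subgraph of G with edge set EH
  Ssub : (EH F F' : EdgeSet m) → Set
  Ssub EH F F' = F' ⊆ EH × F ⊆ F' × ConnBip F'

  Adjacent : Fin m → Fin m → Set
  Adjacent e g = ∃ λ v → Incident v e × Incident v g

  NE : Fin m → EdgeSet m
  NE e g = g ≢ e × Adjacent e g

  NEF : EdgeSet m → EdgeSet m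
  NEF F g = (∃ λ e → e ∈ F × g ∈ NE e) × g ∉ F

  -- edge set of G(F, ≥ e): delete the edges f ∈ N_E(G,F) with f < e
  CutEdges : (_<_ : Fin m → Fin m → Set) → EdgeSet m → Fin m → EdgeSet m
  CutEdges _<_ F e g = ¬ (g ∈ NEF F × g < e)

module Submission where

-- A member F' of S_sub(H, F ∪ {e}) contains the added edge e
-- (`added-edge-member`) and lies inside H.  The graph G(F, ≥ f) deletes
-- exactly the neighbours of F preceding f (`smaller-neighbour-cut`), so no
-- edge set containing a neighbour e < f belongs to S_sub(G(F, ≥ f), ·)
-- (`smaller-neighbour-excluded`).  For distinct e, f in N_E(G,F) the total
-- order makes one of them smaller, and a common member F' of both families
-- would contain that smaller edge while living in the graph from which it was
-- deleted.

open import Defs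
open import Data.Nat using (ℕ)
open import Data.Fin using (Fin)
open import Data.Product using (_×_; _,_)
open import Data.Sum using (inj₂)
open import Level using (0ℓ)
open import Relation.Binary using (Rel; IsStrictTotalOrder; tri<; tri≈; tri>)
open import Relation.Binary.PropositionalEquality using (_≡_; _≢_; refl)
open import Relation.Nullary using (¬_)
open import Relation.Unary using (_∈_; _∉_; _∪_; ｛_｝)

module _ {n m : ℕ} (G : SimpleGraph n m) where

  added-edge-member : ∀ {EH F F' : EdgeSet m} {e : Fin m} →
    Ssub G EH (F ∪ ｛ e ｝) F' → e ∈ F'
  added-edge-member (_ , F∪e⊆F' , _) = F∪e⊆F' (inj₂ refl)

  smaller-neighbour-cut : ∀ (_<_ : Rel (Fin m) 0ℓ) (F : EdgeSet m) {e f : Fin m} →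
    e ∈ NEF G F → e < f → e ∉ CutEdges G _<_ F f
  smaller-neighbour-cut _<_ F e∈N e<f e-kept = e-kept (e∈N , e<f)

  smaller-neighbour-excluded : ∀ (_<_ : Rel (Fin m) 0ℓ) (F : EdgeSet m)
    {e f : Fin m} {A F' : EdgeSet m} → e ∈ NEF G F → e < f → e ∈ F' →
    ¬ Ssub G (CutEdges G _<_ F f) A F'
  smaller-neighbour-excluded _<_ F e∈N e<f e∈F' (F'⊆Cut , _) =
    smaller-neighbour-cut _<_ F e∈N e<f (F'⊆Cut e∈F')

lemma8 : ∀ {n m} (G : SimpleGraph n m) (_<_ : Rel (Fin m) 0ℓ) →
    IsStrictTotalOrder _≡_ _<_ → GraphConnected G →
    (F : EdgeSet m) → ConnBip G F →
    (e f : Fin m) → e ∈ NEF G F → f ∈ NEF G F → e ≢ f →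
    (F' : EdgeSet m) →
    ¬ (Ssub G (CutEdges G _<_ F e) (F ∪ ｛ e ｝) F' ×
    Ssub G (CutEdges G _<_ F f) (F ∪ ｛ f ｝) F')
lemma8 G _<_ sto _ F _ e f e∈N f∈N e≢f _ (F'∈Sₑ , F'∈S_f)
  with IsStrictTotalOrder.compare sto e f
... | tri< e<f _ _ =
  smaller-neighbour-excluded G _<_ F e∈N e<f (added-edge-member G F'∈Sₑ) F'∈S_f
... | tri≈ _ e≡f _ = e≢f e≡f
... | tri> _ _ f<e =
  smaller-neighbour-excluded G _<_ F f∈N f<e (added-edge-member G F'∈S_f) F'∈Sₑ
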